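{- Let $n\ge 1$ and $k\ge 1$ be integers. Then $$S(k,n)+S(k,n-1)=m^{(1^n)}_{(n)}(k),$$ where $(1^n)=(1,1,\dots,1)$ ($n$ ones) and $(n)$ is the one-row partition of $n$.
   Context: $S(k,l)$ denotes the Stirling number of the second kind, the number of partitions of a $k$-element set into $l$ blocks (with $S(k,0)=0$ for $k\ge1$). Partitions are identified with their Ferrers diagrams and ordered by containment $\subseteq$. For a positive integer $K$ and partitions $\lambda,\mu$, a vacillating tableau of length $K$ from $\lambda$ to $\mu$ is a sequence of partitions $\lambda=\lambda^0\supset\lambda^1\subset\lambda^2\supset\cdots\supset\lambda^{2K-1}\subset\lambda^{2K}=\mu$ in which $\lambda^i$ and $\lambda^{i+1}$ differ by exactly one cell for all $i$. The number of such vacillating tableaux is denoted $m^\lambda_\mu(K)$. -}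

module Defs where

open import Data.Nat using (ℕ; zero; suc; _+_; _*_; _≤ᵇ_; _≡ᵇ_)
open import Data.Bool using (Bool; true; false; _∧_; not; if_then_else_)
open import Data.List using (List; []; _∷_; map; length; upTo; replicate; reverse)
open import Data.Nat.ListAction using (sum)
open import Relation.Binary.PropositionalEquality using (_≡_)

S : ℕ → ℕ → ℕ
S zero    zero    = 1
S zero    (suc l) = 0
S (suc k) zero    = 0
S (suc k) (suc l) = suc l * S k (suc l) + S k l

-- A partition is represented by its list of row lengths (Ferrers diagram rows),
-- which must be positive and weakly decreasing.
positiveDecreasing : List ℕ → Bool
positiveDecreasing []           = true
positiveDecreasing (x ∷ [])     = not (x ≡ᵇ 0)
positiveDecreasing (x ∷ y ∷ xs) = (y ≤ᵇ x) ∧ positiveDecreasing (y ∷ xs)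

isPartition : List ℕ → Bool
isPartition = positiveDecreasing

filterᵇ : {A : Set} → (A → Bool) → List A → List A
filterᵇ p []       = []
filterᵇ p (x ∷ xs) = if p x then x ∷ filterᵇ p xs else filterᵇ p xs

-- add one cell at the end of row i (i = length λ means: start a new row)
incAt : ℕ → List ℕ → List ℕ
incAt zero    []       = 1 ∷ []
incAt zero    (x ∷ xs) = suc x ∷ xs
incAt (suc i) []       = []          -- out of range (never used)
incAt (suc i) (x ∷ xs) = x ∷ incAt i xs

decAt : ℕ → List ℕ → List ℕ
decAt i       []       = []
decAt zero    (zero ∷ xs)  = zero ∷ xs
decAt zero    (suc x ∷ xs) = x ∷ xs
decAt (suc i) (x ∷ xs) = x ∷ decAt i xs

isZero : ℕ → Bool
isZero n = n ≡ᵇ 0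

-- drop trailing zero rows (a row emptied at the bottom disappears)
dropTrailingZeros : List ℕ → List ℕ
dropTrailingZeros xs = reverse (dropWhileᵇ (reverse xs))
  where
  dropWhileᵇ : List ℕ → List ℕ
  dropWhileᵇ []       = []
  dropWhileᵇ (zero ∷ ys)  = dropWhileᵇ ys
  dropWhileᵇ (suc y ∷ ys) = suc y ∷ ys

-- All partitions μ ⊃ λ with |μ| = |λ| + 1 (for λ a partition); each listed once.
addCell : List ℕ → List (List ℕ)
addCell λ′ = filterᵇ isPartition (map (λ i → incAt i λ′) (upTo (suc (length λ′))))

-- All partitions ν ⊂ λ with |ν| = |λ| - 1 (for λ a partition); each listed once.
removeCell : List ℕ → List (List ℕ)
removeCell λ′ = filterᵇ isPartition (map (λ i → dropTrailingZeros (decAt i λ′)) (upTo (length λ′)))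

listEq : List ℕ → List ℕ → Bool
listEq []       []       = true
listEq []       (_ ∷ _)  = false
listEq (_ ∷ _)  []       = false
listEq (x ∷ xs) (y ∷ ys) = (x ≡ᵇ y) ∧ listEq xs ys

-- m^λ_μ(K): number of vacillating tableaux
--   λ = λ⁰ ⊃ λ¹ ⊂ λ² ⊃ ⋯ ⊃ λ^{2K-1} ⊂ λ^{2K} = μ
-- (consecutive partitions differing by exactly one cell), counted by
-- recursion on K: choose λ¹ (remove a cell), then λ² (add a cell), then continue.
-- The value at K = 0 (the empty sequence, 1 iff λ = μ) is only an auxiliary base case.
vacillating : List ℕ → List ℕ → ℕ → ℕ
vacillating λ′ μ zero    = if listEq λ′ μ then 1 else 0
vacillating λ′ μ (suc K) =
  sum (map (λ ν → sum (map (λ ρ → vacillating ρ μ K) (addCell ν))) (removeCell λ′))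

column : ℕ → List ℕ
column n = replicate n 1

row : ℕ → List ℕ
row n = n ∷ []

-- Write Up f L and Down f L for the sums of f over the partitions obtained from L by adding, resp.
-- removing, one cell, so that vacillating L μ (K + 1) = Down (Up (λ M → vacillating M μ K)) L. On
-- partitions these operators satisfy the Young-lattice relation Up ∘ Down = Down ∘ Up + id: adding a
-- cell in row i and removing one in row j ≠ i gives the same partition in either order, while the
-- diagonal terms i = j count the addable cells on one side and the removable cells on the other, and a
-- partition has exactly one more of the former. Iterating, Down ∘ Up ∘ Down^j = Down^(j+1) ∘ Up + j Down^j.
-- Let δₘ be the indicator of the one-row partition (m) and eⱼ = Down^j δ₍ₙ₋ⱼ₎. Since Up δ₍ₘ₊₁₎ = δₘ and
-- Up δ₀ = 0, Down (Up eⱼ) = j eⱼ + eⱼ₊₁ (with eₙ₊₁ = 0), which is the recurrence of the Stirling numbers,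
-- so vacillating L (n) K = ∑ⱼ S(K, j) eⱼ(L). On the column (1ⁿ) only the bottom cell can ever be removed,
-- so eⱼ(1ⁿ) = δ₍ₙ₋ⱼ₎(1ⁿ⁻ʲ), which is 1 for j ∈ {n − 1, n} and 0 otherwise.

module Submission where

open import Defs
open import Data.Nat using (ℕ; _+_; _∸_; _≤_)
open import Relation.Binary.PropositionalEquality using (_≡_)

open import Data.Bool using (Bool; true; false; _∧_; if_then_else_; T)
open import Data.Bool.Properties using (∧-identityʳ; ∧-zeroʳ; ∧-comm)
open import Data.Empty using (⊥-elim)
open import Data.List using (List; []; _∷_; _∷ʳ_; map; length; reverse; upTo; applyUpTo)
open import Data.List.Properties using (reverse-++; unfold-reverse; reverse-involutive; length-replicate)
open import Data.List.Reverse using (Reverse; reverseView; []; _∶_∶ʳ_)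
open import Data.Nat using (zero; suc; _*_; _<_; _≡ᵇ_; _<ᵇ_; _≤ᵇ_; z≤n; s≤s; >-nonZero)
open import Data.Nat.ListAction using (sum)
open import Data.Nat.Properties
open import Algebra.Properties.CommutativeSemigroup +-commutativeSemigroup using (interchange; xy∙z≈zy∙x)
open import Data.Product using (_×_; _,_; proj₁)
open import Data.Unit using (tt)
open import Function using (_∘_; id)
open import Relation.Binary.PropositionalEquality
  using (refl; sym; trans; cong; cong₂; subst; _≢_; module ≡-Reasoning)
open import Relation.Nullary using (yes; no)

T⇒≡true : ∀ {b} → T b → b ≡ true
T⇒≡true {true} _ = refl

≡true⇒T : ∀ {b} → b ≡ true → T b
≡true⇒T refl = tt

≤⇒≤ᵇ≡true : ∀ {m n} → m ≤ n → (m ≤ᵇ n) ≡ true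
≤⇒≤ᵇ≡true m≤n = T⇒≡true (≤⇒≤ᵇ m≤n)

≡ᵇ-refl : ∀ n → (n ≡ᵇ n) ≡ true
≡ᵇ-refl n = T⇒≡true (≡⇒≡ᵇ n n refl)

≢⇒≡ᵇ≡false : ∀ {m n} → m ≢ n → (m ≡ᵇ n) ≡ false
≢⇒≡ᵇ≡false {m} {n} m≢n with m ≡ᵇ n in eq
... | true  = ⊥-elim (m≢n (≡ᵇ⇒≡ m n (≡true⇒T eq)))
... | false = refl

∧≡true⇒ : ∀ {x y} → x ∧ y ≡ true → x ≡ true × y ≡ true
∧≡true⇒ {true} {true} _ = refl , refl

∑< : ℕ → (ℕ → ℕ) → ℕ
∑< zero    f = 0
∑< (suc n) f = f 0 + ∑< n (f ∘ suc)

syntax ∑< n (λ i → e) = ∑[ i < n ] e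

∑-cong : ∀ n {f g : ℕ → ℕ} → (∀ i → i < n → f i ≡ g i) → ∑< n f ≡ ∑< n g
∑-cong zero    eq = refl
∑-cong (suc n) eq = cong₂ _+_ (eq 0 (s≤s z≤n)) (∑-cong n (λ i i<n → eq (suc i) (s≤s i<n)))

∑-zero : ∀ n {f : ℕ → ℕ} → (∀ i → i < n → f i ≡ 0) → ∑< n f ≡ 0
∑-zero n eq = trans (∑-cong n eq) (zeros n)
  where
  zeros : ∀ n → ∑[ i < n ] 0 ≡ 0
  zeros zero    = refl
  zeros (suc n) = zeros n

∑-extend : ∀ {m n} (f : ℕ → ℕ) → m ≤ n → (∀ i → m ≤ i → f i ≡ 0) → ∑< m f ≡ ∑< n f
∑-extend {n = n} f z≤n       vanish = sym (∑-zero n (λ i _ → vanish i z≤n))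
∑-extend         f (s≤s m≤n) vanish =
  cong (f 0 +_) (∑-extend (f ∘ suc) m≤n (λ i m≤i → vanish (suc i) (s≤s m≤i)))

∑-distrib-+ : ∀ n (f g : ℕ → ℕ) → ∑[ i < n ] (f i + g i) ≡ ∑< n f + ∑< n g
∑-distrib-+ zero    f g = refl
∑-distrib-+ (suc n) f g =
  trans (cong (f 0 + g 0 +_) (∑-distrib-+ n (f ∘ suc) (g ∘ suc)))
        (interchange (f 0) (g 0) (∑< n (f ∘ suc)) (∑< n (g ∘ suc)))

∑-last : ∀ n (f : ℕ → ℕ) → ∑< (suc n) f ≡ ∑< n f + f n
∑-last zero    f = +-comm (f 0) 0
∑-last (suc n) f = trans (cong (f 0 +_) (∑-last n (f ∘ suc))) (sym (+-assoc (f 0) _ _))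

∑-comm : ∀ m n (f : ℕ → ℕ → ℕ) → ∑[ i < m ] ∑< n (f i) ≡ ∑[ j < n ] ∑[ i < m ] f i j
∑-comm zero    n f = sym (∑-zero n (λ _ _ → refl))
∑-comm (suc m) n f =
  trans (cong (∑< n (f 0) +_) (∑-comm m n (f ∘ suc))) (sym (∑-distrib-+ n (f 0) _))

∑-pick : ∀ n {i} (f : ℕ → ℕ) → i < n → ∑< n f ≡ f i + ∑[ j < n ] (if j ≡ᵇ i then 0 else f j)
∑-pick (suc n) {zero}  f _         = refl
∑-pick (suc n) {suc i} f (s≤s i<n) = begin
  f 0 + ∑< n (f ∘ suc)          ≡⟨ cong (f 0 +_) (∑-pick n (f ∘ suc) i<n) ⟩
  f 0 + (f (suc i) + rest)      ≡⟨ sym (+-assoc (f 0) _ rest) ⟩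
  f 0 + f (suc i) + rest        ≡⟨ cong (_+ rest) (+-comm (f 0) _) ⟩
  f (suc i) + f 0 + rest        ≡⟨ +-assoc (f (suc i)) _ rest ⟩
  f (suc i) + (f 0 + rest)      ∎
  where
  open ≡-Reasoning
  rest : ℕ
  rest = ∑[ j < n ] (if j ≡ᵇ i then 0 else f (suc j))

offDiagonal : ℕ → (ℕ → ℕ → ℕ) → ℕ
offDiagonal N P = ∑[ i < N ] ∑[ j < N ] (if j ≡ᵇ i then 0 else P i j)

∑∑-diagonal+offDiagonal : ∀ N P → ∑[ i < N ] ∑< N (P i) ≡ ∑[ i < N ] P i i + offDiagonal N P
∑∑-diagonal+offDiagonal N P =
  trans (∑-cong N (λ i i<N → ∑-pick N (P i) i<N)) (∑-distrib-+ N (λ i → P i i) _)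

offDiagonal-transpose : ∀ N {P Q : ℕ → ℕ → ℕ} → (∀ i j → i ≢ j → P i j ≡ Q j i) →
  offDiagonal N P ≡ offDiagonal N Q
offDiagonal-transpose N {P} {Q} P≡Qᵀ =
  trans (∑-comm N N (λ i j → if j ≡ᵇ i then 0 else P i j))
        (∑-cong N (λ j _ → ∑-cong N (λ i _ → entry i j)))
  where
  entry : ∀ i j → (if j ≡ᵇ i then 0 else P i j) ≡ (if i ≡ᵇ j then 0 else Q j i)
  entry i j with i ≟ j
  ... | yes refl rewrite ≡ᵇ-refl i = refl
  ... | no i≢j rewrite ≢⇒≡ᵇ≡false i≢j | ≢⇒≡ᵇ≡false (i≢j ∘ sym) = P≡Qᵀ i j i≢j

∑∑-transpose-offDiagonal : ∀ N {P Q : ℕ → ℕ → ℕ} → (∀ i j → i ≢ j → P i j ≡ Q j i) →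
  ∑[ i < N ] ∑< N (P i) + ∑[ i < N ] Q i i ≡ ∑[ j < N ] ∑< N (Q j) + ∑[ i < N ] P i i
∑∑-transpose-offDiagonal N {P} {Q} P≡Qᵀ = begin
  ∑[ i < N ] ∑< N (P i) + diagQ      ≡⟨ cong (_+ diagQ) (∑∑-diagonal+offDiagonal N P) ⟩
  diagP + offDiagonal N P + diagQ    ≡⟨ cong (λ x → diagP + x + diagQ) (offDiagonal-transpose N P≡Qᵀ) ⟩
  diagP + offDiagonal N Q + diagQ    ≡⟨ xy∙z≈zy∙x diagP (offDiagonal N Q) diagQ ⟩
  diagQ + offDiagonal N Q + diagP    ≡⟨ cong (_+ diagP) (∑∑-diagonal+offDiagonal N Q) ⟨
  ∑[ j < N ] ∑< N (Q j) + diagP      ∎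
  where
  open ≡-Reasoning
  diagP diagQ : ℕ
  diagP = ∑[ i < N ] P i i
  diagQ = ∑[ i < N ] Q i i

if-then-0-cong : ∀ {b c : Bool} {x y : ℕ} → b ≡ c → (b ≡ true → x ≡ y) →
  (if b then x else 0) ≡ (if c then y else 0)
if-then-0-cong {true}  refl x≡y = x≡y refl
if-then-0-cong {false} refl _   = refl

if-then-0-∑ : ∀ N b {x} (c : ℕ → Bool) (y : ℕ → ℕ) →
  (b ≡ true → x ≡ ∑[ j < N ] (if c j then y j else 0)) →
  (if b then x else 0) ≡ ∑[ j < N ] (if b ∧ c j then y j else 0)
if-then-0-∑ N true  c y x≡∑ = x≡∑ refl
if-then-0-∑ N false c y _   = sym (∑-zero N (λ _ _ → refl))

sum-map-+ : ∀ {A : Set} (f g : A → ℕ) xs →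
  sum (map (λ x → f x + g x) xs) ≡ sum (map f xs) + sum (map g xs)
sum-map-+ f g []       = refl
sum-map-+ f g (x ∷ xs) =
  trans (cong (f x + g x +_) (sum-map-+ f g xs))
        (interchange (f x) (g x) (sum (map f xs)) (sum (map g xs)))

sum-map-* : ∀ {A : Set} c (f : A → ℕ) xs → sum (map (λ x → c * f x) xs) ≡ c * sum (map f xs)
sum-map-* c f []       = sym (*-zeroʳ c)
sum-map-* c f (x ∷ xs) =
  trans (cong (c * f x +_) (sum-map-* c f xs)) (sym (*-distribˡ-+ c (f x) _))

sum-map-zero : ∀ {A : Set} {f : A → ℕ} → (∀ x → f x ≡ 0) → ∀ xs → sum (map f xs) ≡ 0
sum-map-zero f≡0 []       = refl
sum-map-zero f≡0 (x ∷ xs) = cong₂ _+_ (f≡0 x) (sum-map-zero f≡0 xs)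

sum-map-∑ : ∀ {A : Set} n (h : ℕ → A → ℕ) xs →
  sum (map (λ x → ∑[ j < n ] h j x) xs) ≡ ∑[ j < n ] sum (map (h j) xs)
sum-map-∑ n h []       = sym (∑-zero n (λ _ _ → refl))
sum-map-∑ n h (x ∷ xs) =
  trans (cong (∑[ j < n ] h j x +_) (sum-map-∑ n h xs)) (sym (∑-distrib-+ n (λ j → h j x) _))

sum-map-∑-* : ∀ {A : Set} m (c : ℕ → ℕ) (h : ℕ → A → ℕ) xs →
  sum (map (λ x → ∑[ j < m ] (c j * h j x)) xs) ≡ ∑[ j < m ] (c j * sum (map (h j) xs))
sum-map-∑-* m c h xs =
  trans (sum-map-∑ m (λ j x → c j * h j x) xs) (∑-cong m (λ j _ → sum-map-* (c j) (h j) xs))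

sum-map-filterᵇ-cong : ∀ {A : Set} (p : A → Bool) {f g : A → ℕ} →
  (∀ x → p x ≡ true → f x ≡ g x) → ∀ xs → sum (map f (filterᵇ p xs)) ≡ sum (map g (filterᵇ p xs))
sum-map-filterᵇ-cong p eq []       = refl
sum-map-filterᵇ-cong p eq (x ∷ xs) with p x in px
... | true  = cong₂ _+_ (eq x px) (sum-map-filterᵇ-cong p eq xs)
... | false = sum-map-filterᵇ-cong p eq xs

sum-map-filterᵇ-map-upTo : ∀ {A : Set} (p : A → Bool) (f : A → ℕ) (g : ℕ → A) n →
  sum (map f (filterᵇ p (map g (upTo n)))) ≡ ∑[ i < n ] (if p (g i) then f (g i) else 0)
sum-map-filterᵇ-map-upTo p f g n = go id n
  where
  go : ∀ k n → sum (map f (filterᵇ p (map g (applyUpTo k n))))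
             ≡ ∑[ i < n ] (if p (g (k i)) then f (g (k i)) else 0)
  go k zero = refl
  go k (suc n) with p (g (k 0))
  ... | true  = cong (f (g (k 0)) +_) (go (k ∘ suc) n)
  ... | false = go (k ∘ suc) n

-- Partitions as lists of row lengths

IsPartition : List ℕ → Set
IsPartition L = isPartition L ≡ true

part : List ℕ → ℕ → ℕ
part []       k       = 0
part (x ∷ xs) zero    = x
part (x ∷ xs) (suc k) = part xs k

part-beyond : ∀ L {k} → length L ≤ k → part L k ≡ 0
part-beyond []       _         = refl
part-beyond (x ∷ xs) (s≤s ℓ≤k) = part-beyond xs ℓ≤k

part>0⇒< : ∀ L k → 0 < part L k → k < length L
part>0⇒< (x ∷ xs) zero    _   = s≤s z≤n
part>0⇒< (x ∷ xs) (suc k) x>0 = s≤s (part>0⇒< xs k x>0)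

isPartition-tail : ∀ x xs → IsPartition (x ∷ xs) → IsPartition xs
isPartition-tail x []       _ = refl
isPartition-tail x (y ∷ ys) p with y ≤ᵇ x
... | true = p

isPartition-head>0 : ∀ x xs → IsPartition (x ∷ xs) → 0 < x
isPartition-head>0 (suc x) []       _ = s≤s z≤n
isPartition-head>0 x       (y ∷ ys) p with y ≤ᵇ x in y≤x
... | true = <-≤-trans (isPartition-head>0 y ys p) (≤ᵇ⇒≤ y x (≡true⇒T y≤x))

part-suc-≤ : ∀ L k → IsPartition L → part L (suc k) ≤ part L k
part-suc-≤ []           k       _ = z≤n
part-suc-≤ (x ∷ [])     k       _ = z≤n
part-suc-≤ (x ∷ y ∷ ys) zero    p with y ≤ᵇ x in y≤x
... | true = ≤ᵇ⇒≤ y x (≡true⇒T y≤x)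
part-suc-≤ (x ∷ y ∷ ys) (suc k) p = part-suc-≤ (y ∷ ys) k (isPartition-tail x (y ∷ ys) p)

isPartition-∷ : ∀ x M → 0 < x → isPartition (x ∷ M) ≡ (part M 0 ≤ᵇ x) ∧ isPartition M
isPartition-∷ (suc x) []       _ = refl
isPartition-∷ x       (y ∷ ys) _ = refl

part-injective : ∀ L M → IsPartition L → IsPartition M → (∀ k → part L k ≡ part M k) → L ≡ M
part-injective []       []       _  _  _  = refl
part-injective []       (y ∷ ys) _  pM eq = ⊥-elim (<⇒≢ (isPartition-head>0 y ys pM) (eq 0))
part-injective (x ∷ xs) []       pL _  eq = ⊥-elim (<⇒≢ (isPartition-head>0 x xs pL) (sym (eq 0)))
part-injective (x ∷ xs) (y ∷ ys) pL pM eq =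
  cong₂ _∷_ (eq 0) (part-injective xs ys (isPartition-tail x xs pL) (isPartition-tail y ys pM) (eq ∘ suc))

consTrim : ℕ → List ℕ → List ℕ
consTrim x       (y ∷ ys) = x ∷ y ∷ ys
consTrim zero    []       = []
consTrim (suc x) []       = suc x ∷ []

trimZeros : List ℕ → List ℕ
trimZeros []       = []
trimZeros (x ∷ xs) = consTrim x (trimZeros xs)

consTrim-suc : ∀ x t → consTrim (suc x) t ≡ suc x ∷ t
consTrim-suc x []      = refl
consTrim-suc x (_ ∷ _) = refl

trimZeros-∷ʳ-zero : ∀ xs → trimZeros (xs ∷ʳ 0) ≡ trimZeros xs
trimZeros-∷ʳ-zero []       = refl
trimZeros-∷ʳ-zero (y ∷ ys) = cong (consTrim y) (trimZeros-∷ʳ-zero ys)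

trimZeros-∷ʳ-suc : ∀ xs x → trimZeros (xs ∷ʳ suc x) ≡ xs ∷ʳ suc x
trimZeros-∷ʳ-suc []       x = refl
trimZeros-∷ʳ-suc (y ∷ ys) x = trans (cong (consTrim y) (trimZeros-∷ʳ-suc ys x)) (consTrim-∷ʳ ys)
  where
  consTrim-∷ʳ : ∀ ys → consTrim y (ys ∷ʳ suc x) ≡ y ∷ ys ∷ʳ suc x
  consTrim-∷ʳ []      = refl
  consTrim-∷ʳ (_ ∷ _) = refl

dropTrailingZeros≡trimZeros : ∀ xs → dropTrailingZeros xs ≡ trimZeros xs
dropTrailingZeros≡trimZeros xs = go xs (reverseView xs)
  where
  reverse-∷ʳ : ∀ (xs : List ℕ) x → reverse (xs ∷ʳ x) ≡ x ∷ reverse xs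
  reverse-∷ʳ xs x = reverse-++ xs (x ∷ [])
  go : ∀ xs → Reverse xs → dropTrailingZeros xs ≡ trimZeros xs
  go .[]             []                = refl
  go .(xs ∷ʳ zero)   (xs ∶ v ∶ʳ zero)  rewrite reverse-∷ʳ xs 0 =
    trans (go xs v) (sym (trimZeros-∷ʳ-zero xs))
  go .(xs ∷ʳ suc x)  (xs ∶ _ ∶ʳ suc x) rewrite reverse-∷ʳ xs (suc x) =
    trans (trans (unfold-reverse (suc x) (reverse xs)) (cong (_∷ʳ suc x) (reverse-involutive xs)))
          (sym (trimZeros-∷ʳ-suc xs x))

trimZeros-partition : ∀ L → IsPartition L → trimZeros L ≡ L
trimZeros-partition []       _ = refl
trimZeros-partition (x ∷ xs) p with isPartition-head>0 x xs p
... | s≤s _ = trans (cong (consTrim x) (trimZeros-partition xs (isPartition-tail x xs p))) (consTrim-suc _ xs)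

part-trimZeros : ∀ L k → part (trimZeros L) k ≡ part L k
part-trimZeros []       k = refl
part-trimZeros (x ∷ xs) k = trans (part-consTrim x (trimZeros xs) k) (part-∷ k)
  where
  part-consTrim : ∀ x t k → part (consTrim x t) k ≡ part (x ∷ t) k
  part-consTrim zero    []      zero    = refl
  part-consTrim zero    []      (suc k) = refl
  part-consTrim (suc x) []      k       = refl
  part-consTrim x       (_ ∷ _) k       = refl
  part-∷ : ∀ k → part (x ∷ trimZeros xs) k ≡ part (x ∷ xs) k
  part-∷ zero    = refl
  part-∷ (suc k) = part-trimZeros xs k

length-trimZeros : ∀ L → length (trimZeros L) ≤ length L
length-trimZeros []       = z≤n
length-trimZeros (x ∷ xs) = ≤-trans (length-consTrim x (trimZeros xs)) (s≤s (length-trimZeros xs))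
  where
  length-consTrim : ∀ x t → length (consTrim x t) ≤ suc (length t)
  length-consTrim zero    []      = z≤n
  length-consTrim (suc x) []      = ≤-refl
  length-consTrim x       (_ ∷ _) = ≤-refl

raise : (ℕ → ℕ) → ℕ → ℕ → ℕ
raise a i k = if k ≡ᵇ i then suc (a k) else a k

lower : (ℕ → ℕ) → ℕ → ℕ → ℕ
lower a j k = if k ≡ᵇ j then a k ∸ 1 else a k

raise-cong : ∀ {a b} i → (∀ k → a k ≡ b k) → ∀ k → raise a i k ≡ raise b i k
raise-cong i a≗b k = cong (λ x → if k ≡ᵇ i then suc x else x) (a≗b k)

lower-cong : ∀ {a b} j → (∀ k → a k ≡ b k) → ∀ k → lower a j k ≡ lower b j k
lower-cong j a≗b k = cong (λ x → if k ≡ᵇ j then x ∸ 1 else x) (a≗b k)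

lower-≤ : ∀ a j k → lower a j k ≤ a k
lower-≤ a j k with k ≡ᵇ j
... | true  = m∸n≤m (a k) 1
... | false = ≤-refl

lower-raise : ∀ a {i j} → i ≢ j → ∀ k → lower (raise a i) j k ≡ raise (lower a j) i k
lower-raise a {i} {j} i≢j k with k ≡ᵇ i in k≡i | k ≡ᵇ j in k≡j
... | true  | true  =
  ⊥-elim (i≢j (trans (sym (≡ᵇ⇒≡ k i (≡true⇒T k≡i))) (≡ᵇ⇒≡ k j (≡true⇒T k≡j))))
... | true  | false = refl
... | false | true  = refl
... | false | false = refl

lower-raise-same : ∀ a i k → lower (raise a i) i k ≡ a k
lower-raise-same a i k with k ≡ᵇ i
... | true  = refl
... | false = refl

raise-lower-same : ∀ a j → 0 < a j → ∀ k → raise (lower a j) j k ≡ a k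
raise-lower-same a j a>0 k with k ≡ᵇ j in k≡j
... | false = refl
... | true rewrite ≡ᵇ⇒≡ k j (≡true⇒T k≡j) = suc-pred (a j) {{>-nonZero a>0}}

addable : (ℕ → ℕ) → ℕ → Bool
addable a zero    = true
addable a (suc i) = a (suc i) <ᵇ a i

removable : (ℕ → ℕ) → ℕ → Bool
removable a j = a (suc j) <ᵇ a j

addable-cong : ∀ {a b} i → (∀ k → a k ≡ b k) → addable a i ≡ addable b i
addable-cong zero    a≗b = refl
addable-cong (suc i) a≗b = cong₂ _<ᵇ_ (a≗b (suc i)) (a≗b i)

removable-cong : ∀ {a b} j → (∀ k → a k ≡ b k) → removable a j ≡ removable b j
removable-cong j a≗b = cong₂ _<ᵇ_ (a≗b (suc j)) (a≗b j)

addable-removable-swap : ∀ a i j → i ≢ j →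
  addable a i ∧ removable (raise a i) j ≡ removable a j ∧ addable (lower a j) i
addable-removable-swap a zero          zero          i≢j = ⊥-elim (i≢j refl)
addable-removable-swap a zero          (suc j)       _   = sym (∧-identityʳ _)
addable-removable-swap a (suc zero)    zero          _   = cong ((a 1 <ᵇ a 0) ∧_) (suc<ᵇ (a 1) (a 0))
  where
  suc<ᵇ : ∀ x y → (suc x <ᵇ y) ≡ (x <ᵇ y ∸ 1)
  suc<ᵇ x zero    = refl
  suc<ᵇ x (suc y) = refl
addable-removable-swap a (suc (suc i)) zero          _   = ∧-comm (a (2 + i) <ᵇ a (suc i)) (a 1 <ᵇ a 0)
addable-removable-swap a (suc zero)    (suc zero)    i≢j = ⊥-elim (i≢j refl)
addable-removable-swap a (suc zero)    (suc (suc j)) _   = ∧-comm (a 1 <ᵇ a 0) (a (3 + j) <ᵇ a (2 + j))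
addable-removable-swap a (suc (suc i)) (suc j)       i≢j =
  addable-removable-swap (a ∘ suc) (suc i) j (i≢j ∘ cong suc)

removeAt : ℕ → List ℕ → List ℕ
removeAt j L = trimZeros (decAt j L)

part-incAt : ∀ i L k → i ≤ length L → part (incAt i L) k ≡ raise (part L) i k
part-incAt zero    []       zero    _         = refl
part-incAt zero    []       (suc k) _         = refl
part-incAt zero    (x ∷ xs) zero    _         = refl
part-incAt zero    (x ∷ xs) (suc k) _         = refl
part-incAt (suc i) (x ∷ xs) zero    _         = refl
part-incAt (suc i) (x ∷ xs) (suc k) (s≤s i≤ℓ) = part-incAt i xs k i≤ℓ

part-removeAt : ∀ j L k → part (removeAt j L) k ≡ lower (part L) j k
part-removeAt j L k = trans (part-trimZeros (decAt j L) k) (part-decAt j L k)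
  where
  part-decAt : ∀ j L k → part (decAt j L) k ≡ lower (part L) j k
  part-decAt j       []           k       with k ≡ᵇ j
  ... | true  = refl
  ... | false = refl
  part-decAt zero    (zero ∷ xs)  zero    = refl
  part-decAt zero    (zero ∷ xs)  (suc k) = refl
  part-decAt zero    (suc x ∷ xs) zero    = refl
  part-decAt zero    (suc x ∷ xs) (suc k) = refl
  part-decAt (suc j) (x ∷ xs)     zero    = refl
  part-decAt (suc j) (x ∷ xs)     (suc k) = part-decAt j xs k

length-incAt : ∀ i L → length (incAt i L) ≤ suc (length L)
length-incAt zero    []       = ≤-refl
length-incAt zero    (x ∷ xs) = n≤1+n _
length-incAt (suc i) []       = z≤n
length-incAt (suc i) (x ∷ xs) = s≤s (length-incAt i xs)

length-removeAt : ∀ j L → length (removeAt j L) ≤ length L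
length-removeAt j L = ≤-trans (length-trimZeros (decAt j L)) (≤-reflexive (length-decAt j L))
  where
  length-decAt : ∀ j L → length (decAt j L) ≡ length L
  length-decAt j       []           = refl
  length-decAt zero    (zero ∷ xs)  = refl
  length-decAt zero    (suc x ∷ xs) = refl
  length-decAt (suc j) (x ∷ xs)     = cong suc (length-decAt j xs)

isPartition-incAt : ∀ i L → IsPartition L → i ≤ length L →
  isPartition (incAt i L) ≡ addable (part L) i
isPartition-incAt zero    []       _ _         = refl
isPartition-incAt zero    (x ∷ xs) p _         =
  trans (isPartition-∷ (suc x) xs (s≤s z≤n))
        (cong₂ _∧_ (≤⇒≤ᵇ≡true (m≤n⇒m≤1+n (part-suc-≤ (x ∷ xs) 0 p))) (isPartition-tail x xs p))
isPartition-incAt (suc i) (x ∷ xs) p (s≤s i≤ℓ) =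
  trans (isPartition-∷ x (incAt i xs) (isPartition-head>0 x xs p))
        (trans (cong ((part (incAt i xs) 0 ≤ᵇ x) ∧_) (isPartition-incAt i xs (isPartition-tail x xs p) i≤ℓ))
               (first-row i i≤ℓ))
  where
  first-row : ∀ i → i ≤ length xs →
    (part (incAt i xs) 0 ≤ᵇ x) ∧ addable (part xs) i ≡ addable (part (x ∷ xs)) (suc i)
  first-row zero    i≤ℓ rewrite part-incAt zero xs 0 i≤ℓ = ∧-identityʳ _
  first-row (suc i) i≤ℓ rewrite part-incAt (suc i) xs 0 i≤ℓ =
    cong (_∧ addable (part xs) (suc i)) (≤⇒≤ᵇ≡true (part-suc-≤ (x ∷ xs) 0 p))

isPartition-removeAt : ∀ j L → IsPartition L → j < length L →
  isPartition (removeAt j L) ≡ removable (part L) j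
isPartition-removeAt zero    (x ∷ xs) p _ with isPartition-head>0 x xs p
... | s≤s {n = x′} _ rewrite trimZeros-partition xs (isPartition-tail x xs p) =
  isPartition-consTrim x′ xs (isPartition-tail x xs p)
  where
  isPartition-consTrim : ∀ x xs → IsPartition xs → isPartition (consTrim x xs) ≡ (part xs 0 <ᵇ suc x)
  isPartition-consTrim zero    []           _ = refl
  isPartition-consTrim (suc _) []           _ = refl
  isPartition-consTrim x       (zero ∷ ys)  p rewrite p = refl
  isPartition-consTrim x       (suc y ∷ ys) p rewrite p = ∧-identityʳ (y <ᵇ x)
isPartition-removeAt (suc j) (x ∷ xs) p (s≤s j<ℓ) with isPartition-head>0 x xs p
... | s≤s {n = x′} _ =
  trans (cong isPartition (consTrim-suc x′ (removeAt j xs)))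
        (trans (isPartition-∷ (suc x′) (removeAt j xs) (s≤s z≤n))
               (cong₂ _∧_ (≤⇒≤ᵇ≡true first-row)
                          (isPartition-removeAt j xs (isPartition-tail x xs p) j<ℓ)))
  where
  first-row : part (removeAt j xs) 0 ≤ suc x′
  first-row = ≤-trans (≤-reflexive (part-removeAt j xs 0))
                      (≤-trans (lower-≤ (part xs) j 0) (part-suc-≤ (suc x′ ∷ xs) 0 p))

addable⇒≤length : ∀ L i → addable (part L) i ≡ true → i ≤ length L
addable⇒≤length L zero    _   = z≤n
addable⇒≤length L (suc i) add = part>0⇒< L i (<-≤-trans (s≤s z≤n) (<ᵇ⇒< _ _ (≡true⇒T add)))

removable⇒<length : ∀ L j → removable (part L) j ≡ true → j < length L
removable⇒<length L j rem = part>0⇒< L j (<-≤-trans (s≤s z≤n) (<ᵇ⇒< _ _ (≡true⇒T rem)))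

addable-beyond : ∀ L i → suc (length L) ≤ i → addable (part L) i ≡ false
addable-beyond L (suc i) (s≤s ℓ≤i) rewrite part-beyond L ℓ≤i = refl

removable-beyond : ∀ L j → length L ≤ j → removable (part L) j ≡ false
removable-beyond L j ℓ≤j rewrite part-beyond L ℓ≤j = refl

-- The up and down operators

Up : (List ℕ → ℕ) → List ℕ → ℕ
Up f L = sum (map f (addCell L))

Down : (List ℕ → ℕ) → List ℕ → ℕ
Down f L = sum (map f (removeCell L))

_≗ₚ_ : (f g : List ℕ → ℕ) → Set
f ≗ₚ g = ∀ L → IsPartition L → f L ≡ g L

Up-cong : ∀ {f g} → f ≗ₚ g → ∀ L → Up f L ≡ Up g L
Up-cong f≗g L = sum-map-filterᵇ-cong isPartition f≗g (map (λ i → incAt i L) (upTo (suc (length L))))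

Down-cong : ∀ {f g} → f ≗ₚ g → ∀ L → Down f L ≡ Down g L
Down-cong f≗g L =
  sum-map-filterᵇ-cong isPartition f≗g (map (λ j → dropTrailingZeros (decAt j L)) (upTo (length L)))

Up-∑ : ∀ L N f → IsPartition L → suc (length L) ≤ N →
  Up f L ≡ ∑[ i < N ] (if addable (part L) i then f (incAt i L) else 0)
Up-∑ L N f p ℓ<N = begin
  Up f L
    ≡⟨ sum-map-filterᵇ-map-upTo isPartition f (λ i → incAt i L) (suc (length L)) ⟩
  ∑[ i < suc (length L) ] (if isPartition (incAt i L) then f (incAt i L) else 0)
    ≡⟨ ∑-cong (suc (length L)) (λ i i≤ℓ → guard i (isPartition-incAt i L p (≤-pred i≤ℓ))) ⟩
  ∑[ i < suc (length L) ] (if addable (part L) i then f (incAt i L) else 0)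
    ≡⟨ ∑-extend (λ i → if addable (part L) i then f (incAt i L) else 0) ℓ<N
                (λ i ℓ<i → guard i (addable-beyond L i ℓ<i)) ⟩
  ∑[ i < N ] (if addable (part L) i then f (incAt i L) else 0) ∎
  where
  open ≡-Reasoning
  guard : ∀ i {b c} → b ≡ c → (if b then f (incAt i L) else 0) ≡ (if c then f (incAt i L) else 0)
  guard i = cong (λ b → if b then f (incAt i L) else 0)

Down-∑ : ∀ L N f → IsPartition L → length L ≤ N →
  Down f L ≡ ∑[ j < N ] (if removable (part L) j then f (removeAt j L) else 0)
Down-∑ L N f p ℓ≤N = begin
  Down f L
    ≡⟨ sum-map-filterᵇ-map-upTo isPartition f (λ j → dropTrailingZeros (decAt j L)) (length L) ⟩
  ∑[ j < length L ] (if isPartition (dropTrailingZeros (decAt j L)) then f (dropTrailingZeros (decAt j L)) else 0)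
    ≡⟨ ∑-cong (length L) (λ j j<ℓ →
         trans (cong (λ M → if isPartition M then f M else 0) (dropTrailingZeros≡trimZeros (decAt j L)))
               (guard j (isPartition-removeAt j L p j<ℓ))) ⟩
  ∑[ j < length L ] (if removable (part L) j then f (removeAt j L) else 0)
    ≡⟨ ∑-extend (λ j → if removable (part L) j then f (removeAt j L) else 0) ℓ≤N
                (λ j ℓ≤j → guard j (removable-beyond L j ℓ≤j)) ⟩
  ∑[ j < N ] (if removable (part L) j then f (removeAt j L) else 0) ∎
  where
  open ≡-Reasoning
  guard : ∀ j {b c} → b ≡ c → (if b then f (removeAt j L) else 0) ≡ (if c then f (removeAt j L) else 0)
  guard j = cong (λ b → if b then f (removeAt j L) else 0)

module Up-Down-commutation (f : List ℕ → ℕ) {L : List ℕ} (p : IsPartition L) where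

  a : ℕ → ℕ
  a = part L

  N : ℕ
  N = 2 + length L

  upGuard downGuard : ℕ → ℕ → Bool
  upGuard   i j = addable a i ∧ removable (part (incAt i L)) j
  downGuard j i = removable a j ∧ addable (part (removeAt j L)) i

  upDown downUp : ℕ → ℕ → ℕ
  upDown i j = if upGuard i j then f (removeAt j (incAt i L)) else 0
  downUp j i = if downGuard j i then f (incAt i (removeAt j L)) else 0

  incAt-partition : ∀ i → addable a i ≡ true → IsPartition (incAt i L)
  incAt-partition i add = trans (isPartition-incAt i L p (addable⇒≤length L i add)) add

  removeAt-partition : ∀ j → removable a j ≡ true → IsPartition (removeAt j L)
  removeAt-partition j rem = trans (isPartition-removeAt j L p (removable⇒<length L j rem)) rem

  Up-Down-∑∑ : Up (Down f) L ≡ ∑[ i < N ] ∑< N (upDown i)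
  Up-Down-∑∑ = trans (Up-∑ L N (Down f) p (n≤1+n _)) (∑-cong N (λ i _ → summand i))
    where
    summand : ∀ i → (if addable a i then Down f (incAt i L) else 0) ≡ ∑< N (upDown i)
    summand i = if-then-0-∑ N (addable a i) (removable (part (incAt i L))) (λ j → f (removeAt j (incAt i L)))
      λ add → Down-∑ (incAt i L) N f (incAt-partition i add) (≤-trans (length-incAt i L) (n≤1+n _))

  Down-Up-∑∑ : Down (Up f) L ≡ ∑[ j < N ] ∑< N (downUp j)
  Down-Up-∑∑ = trans (Down-∑ L N (Up f) p (≤-trans (n≤1+n _) (n≤1+n _)))
                     (∑-cong N (λ j _ → summand j))
    where
    summand : ∀ j → (if removable a j then Up f (removeAt j L) else 0) ≡ ∑< N (downUp j)
    summand j = if-then-0-∑ N (removable a j) (addable (part (removeAt j L))) (λ i → f (incAt i (removeAt j L)))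
      λ rem → Up-∑ (removeAt j L) N f (removeAt-partition j rem) (s≤s (≤-trans (length-removeAt j L) (n≤1+n _)))

  part-incAt-addable : ∀ i → addable a i ≡ true → ∀ k → part (incAt i L) k ≡ raise a i k
  part-incAt-addable i add k = part-incAt i L k (addable⇒≤length L i add)

  upGuard-raise : ∀ i j → upGuard i j ≡ addable a i ∧ removable (raise a i) j
  upGuard-raise i j with addable a i in add
  ... | true  = removable-cong j (part-incAt-addable i add)
  ... | false = refl

  downGuard-lower : ∀ j i → downGuard j i ≡ removable a j ∧ addable (lower a j) i
  downGuard-lower j i = cong (removable a j ∧_) (addable-cong i (part-removeAt j L))

  upDown-partition : ∀ i j → upGuard i j ≡ true → IsPartition (removeAt j (incAt i L))
  upDown-partition i j g with ∧≡true⇒ g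
  ... | add , rem =
    trans (isPartition-removeAt j (incAt i L) (incAt-partition i add) (removable⇒<length (incAt i L) j rem)) rem

  downUp-partition : ∀ j i → downGuard j i ≡ true → IsPartition (incAt i (removeAt j L))
  downUp-partition j i g with ∧≡true⇒ g
  ... | rem , add =
    trans (isPartition-incAt i (removeAt j L) (removeAt-partition j rem) (addable⇒≤length (removeAt j L) i add)) add

  upDown≡downUpᵀ : ∀ i j → i ≢ j → upDown i j ≡ downUp j i
  upDown≡downUpᵀ i j i≢j = if-then-0-cong guards (λ g → cong f (part-injective _ _ (upDown-partition i j g)
                                                                 (downUp-partition j i (trans (sym guards) g))
                                                                 (parts g)))
    where
    guards : upGuard i j ≡ downGuard j i
    guards = trans (upGuard-raise i j) (trans (addable-removable-swap a i j i≢j) (sym (downGuard-lower j i)))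
    parts : upGuard i j ≡ true →
      ∀ k → part (removeAt j (incAt i L)) k ≡ part (incAt i (removeAt j L)) k
    parts g k with ∧≡true⇒ g | ∧≡true⇒ (trans (sym guards) g)
    ... | add , _ | rem , add′ = begin
      part (removeAt j (incAt i L)) k             ≡⟨ part-removeAt j (incAt i L) k ⟩
      lower (part (incAt i L)) j k                ≡⟨ lower-cong j (part-incAt-addable i add) k ⟩
      lower (raise a i) j k                       ≡⟨ lower-raise a {i} {j} i≢j k ⟩
      raise (lower a j) i k                       ≡⟨ raise-cong i (part-removeAt j L) k ⟨
      raise (part (removeAt j L)) i k             ≡⟨ part-incAt i (removeAt j L) k (addable⇒≤length (removeAt j L) i add′) ⟨
      part (incAt i (removeAt j L)) k             ∎
      where open ≡-Reasoning

  removable-raise : ∀ i → removable (raise a i) i ≡ true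
  removable-raise i rewrite ≡ᵇ-refl i | ≢⇒≡ᵇ≡false (1+n≢n {i}) =
    T⇒≡true (<⇒<ᵇ (s≤s (part-suc-≤ L i p)))

  addable-lower : ∀ j → removable a j ≡ true → addable (lower a j) j ≡ true
  addable-lower zero    _   = refl
  addable-lower (suc j) rem rewrite ≡ᵇ-refl j | ≢⇒≡ᵇ≡false (1+n≢n {j} ∘ sym) =
    T⇒≡true (<⇒<ᵇ (pred< (<-≤-trans (s≤s z≤n) (<ᵇ⇒< _ _ (≡true⇒T rem))) (part-suc-≤ L j p)))
    where
    pred< : ∀ {x y} → 0 < x → x ≤ y → x ∸ 1 < y
    pred< {suc x} _ x<y = x<y

  upDown-diagonal : ∀ i → upDown i i ≡ (if addable a i then f L else 0)
  upDown-diagonal i = if-then-0-cong guard λ g →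
    cong f (part-injective _ L (upDown-partition i i g) p (parts (proj₁ (∧≡true⇒ g))))
    where
    guard : upGuard i i ≡ addable a i
    guard with addable a i in add
    ... | true  = trans (removable-cong i (part-incAt-addable i add)) (removable-raise i)
    ... | false = refl
    parts : addable a i ≡ true → ∀ k → part (removeAt i (incAt i L)) k ≡ a k
    parts add k = begin
      part (removeAt i (incAt i L)) k   ≡⟨ part-removeAt i (incAt i L) k ⟩
      lower (part (incAt i L)) i k      ≡⟨ lower-cong i (part-incAt-addable i add) k ⟩
      lower (raise a i) i k             ≡⟨ lower-raise-same a i k ⟩
      a k                               ∎
      where open ≡-Reasoning

  downUp-diagonal : ∀ j → downUp j j ≡ (if removable a j then f L else 0)
  downUp-diagonal j = if-then-0-cong guard λ g →
    cong f (part-injective _ L (downUp-partition j j g) p (parts (∧≡true⇒ g)))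
    where
    guard : downGuard j j ≡ removable a j
    guard with removable a j in rem
    ... | true  = trans (addable-cong j (part-removeAt j L)) (addable-lower j rem)
    ... | false = refl
    parts : removable a j ≡ true × addable (part (removeAt j L)) j ≡ true →
      ∀ k → part (incAt j (removeAt j L)) k ≡ a k
    parts (rem , add) k = begin
      part (incAt j (removeAt j L)) k   ≡⟨ part-incAt j (removeAt j L) k (addable⇒≤length (removeAt j L) j add) ⟩
      raise (part (removeAt j L)) j k   ≡⟨ raise-cong j (part-removeAt j L) k ⟩
      raise (lower a j) j k             ≡⟨ raise-lower-same a j (<-≤-trans (s≤s z≤n) (<ᵇ⇒< _ _ (≡true⇒T rem))) k ⟩
      a k                               ∎
      where open ≡-Reasoning

  ∑-addable≡+∑-removable : ∀ x →
    ∑[ i < N ] (if addable a i then x else 0) ≡ x + ∑[ j < N ] (if removable a j then x else 0)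
  ∑-addable≡+∑-removable x = cong (x +_) (∑-extend (λ j → if removable a j then x else 0) (n≤1+n _)
    (λ j ℓ<j → cong (λ b → if b then x else 0) (removable-beyond L j (≤-trans (n≤1+n _) ℓ<j))))

  Up-Down≡Down-Up+id : Up (Down f) L ≡ Down (Up f) L + f L
  Up-Down≡Down-Up+id = +-cancelʳ-≡ diagDownUp _ _ (begin
    Up (Down f) L + diagDownUp                          ≡⟨ cong (_+ diagDownUp) Up-Down-∑∑ ⟩
    ∑[ i < N ] ∑< N (upDown i) + diagDownUp             ≡⟨ ∑∑-transpose-offDiagonal N upDown≡downUpᵀ ⟩
    ∑[ j < N ] ∑< N (downUp j) + ∑[ i < N ] upDown i i  ≡⟨ cong₂ _+_ (sym Down-Up-∑∑) diagUpDown ⟩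
    Down (Up f) L + (f L + diagDownUp)                  ≡⟨ +-assoc (Down (Up f) L) (f L) diagDownUp ⟨
    Down (Up f) L + f L + diagDownUp                    ∎)
    where
    open ≡-Reasoning
    diagDownUp : ℕ
    diagDownUp = ∑[ j < N ] downUp j j
    diagUpDown : ∑[ i < N ] upDown i i ≡ f L + diagDownUp
    diagUpDown = begin
      ∑[ i < N ] upDown i i                                ≡⟨ ∑-cong N (λ i _ → upDown-diagonal i) ⟩
      ∑[ i < N ] (if addable a i then f L else 0)          ≡⟨ ∑-addable≡+∑-removable (f L) ⟩
      f L + ∑[ j < N ] (if removable a j then f L else 0)  ≡⟨ cong (f L +_) (∑-cong N (λ j _ → downUp-diagonal j)) ⟨
      f L + diagDownUp                                     ∎

open Up-Down-commutation using (Up-Down≡Down-Up+id)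

Down^ : ℕ → (List ℕ → ℕ) → List ℕ → ℕ
Down^ zero    f = f
Down^ (suc j) f = Down (Down^ j f)

Down^-cong : ∀ j {f g} → f ≗ₚ g → Down^ j f ≗ₚ Down^ j g
Down^-cong zero    f≗g = f≗g
Down^-cong (suc j) f≗g L _ = Down-cong (Down^-cong j f≗g) L

Down^-zero : ∀ j L → Down^ j (λ _ → 0) L ≡ 0
Down^-zero zero    L = refl
Down^-zero (suc j) L = sum-map-zero (Down^-zero j) (removeCell L)

Down-+-* : ∀ f g c L → Down (λ M → f M + c * g M) L ≡ Down f L + c * Down g L
Down-+-* f g c L =
  trans (sum-map-+ f (λ M → c * g M) (removeCell L)) (cong (Down f L +_) (sum-map-* c g (removeCell L)))

Down-Up-Down^ : ∀ j f L → Down (Up (Down^ j f)) L ≡ Down^ (suc j) (Up f) L + j * Down^ j f L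
Down-Up-Down^ zero    f L = sym (+-identityʳ _)
Down-Up-Down^ (suc j) f L =
  trans (Down-cong Up-Down^-suc L) (Down-+-* (Down^ (suc j) (Up f)) (Down^ j f) (suc j) L)
  where
  Up-Down^-suc : Up (Down^ (suc j) f) ≗ₚ λ M → Down^ (suc j) (Up f) M + suc j * Down^ j f M
  Up-Down^-suc M p = begin
    Up (Down (Down^ j f)) M          ≡⟨ Up-Down≡Down-Up+id (Down^ j f) p ⟩
    Down (Up (Down^ j f)) M + d      ≡⟨ cong (_+ d) (Down-Up-Down^ j f M) ⟩
    u + j * d + d                    ≡⟨ +-assoc u (j * d) d ⟩
    u + (j * d + d)                  ≡⟨ cong (u +_) (+-comm (j * d) d) ⟩
    u + suc j * d                    ∎
    where
    open ≡-Reasoning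
    u d : ℕ
    u = Down^ (suc j) (Up f) M
    d = Down^ j f M

-- Unlike row 0 = 0 ∷ [], oneRow 0 is the empty partition.
oneRow : ℕ → List ℕ
oneRow zero    = []
oneRow (suc m) = suc m ∷ []

δ-oneRow : ℕ → List ℕ → ℕ
δ-oneRow m L = if listEq L (oneRow m) then 1 else 0

δ-oneRow-long : ∀ m x y ys → δ-oneRow m (x ∷ y ∷ ys) ≡ 0
δ-oneRow-long zero    x y ys = refl
δ-oneRow-long (suc m) x y ys rewrite ∧-zeroʳ (x ≡ᵇ suc m) = refl

Up-δ-oneRow : ∀ m L → IsPartition L → Up (δ-oneRow m) L ≡ δ-oneRow m (incAt 0 L)
Up-δ-oneRow m L p =
  trans (Up-∑ L (suc (length L)) (δ-oneRow m) p ≤-refl)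
        (trans (cong (δ-oneRow m (incAt 0 L) +_) (∑-zero (length L) (λ i i<ℓ → other-rows L i i<ℓ)))
               (+-identityʳ _))
  where
  long : ∀ x i xs → i ≤ length xs → δ-oneRow m (x ∷ incAt i xs) ≡ 0
  long x zero    []       _ = δ-oneRow-long m x 1 []
  long x zero    (y ∷ ys) _ = δ-oneRow-long m x (suc y) ys
  long x (suc i) (y ∷ ys) _ = δ-oneRow-long m x y (incAt i ys)
  other-rows : ∀ L i → i < length L →
    (if addable (part L) (suc i) then δ-oneRow m (incAt (suc i) L) else 0) ≡ 0
  other-rows (x ∷ xs) i (s≤s i≤ℓ) rewrite long x i xs i≤ℓ with addable (part (x ∷ xs)) (suc i)
  ... | true  = refl
  ... | false = refl

Up-δ-oneRow-suc : ∀ m → Up (δ-oneRow (suc m)) ≗ₚ δ-oneRow m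
Up-δ-oneRow-suc m L p = trans (Up-δ-oneRow (suc m) L p) (lengthen m L p)
  where
  lengthen : ∀ m L → IsPartition L → δ-oneRow (suc m) (incAt 0 L) ≡ δ-oneRow m L
  lengthen zero    []       _ = refl
  lengthen (suc m) []       _ = refl
  lengthen zero    (x ∷ xs) p with isPartition-head>0 x xs p
  ... | s≤s _ = refl
  lengthen (suc m) (x ∷ xs) _ = refl

Up-δ-oneRow-zero : Up (δ-oneRow 0) ≗ₚ λ _ → 0
Up-δ-oneRow-zero L p = trans (Up-δ-oneRow 0 L p) (nonempty L)
  where
  nonempty : ∀ L → δ-oneRow 0 (incAt 0 L) ≡ 0
  nonempty []       = refl
  nonempty (x ∷ xs) = refl

isPartition-column : ∀ m → IsPartition (column m)
isPartition-column zero          = refl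
isPartition-column (suc zero)    = refl
isPartition-column (suc (suc m)) = isPartition-column (suc m)

part-column : ∀ {m k} → k < m → part (column m) k ≡ 1
part-column {suc m} {zero}  _         = refl
part-column {suc m} {suc k} (s≤s k<m) = part-column k<m

removeAt-column : ∀ m → removeAt m (column (suc m)) ≡ column m
removeAt-column zero    = refl
removeAt-column (suc m) = trans (consTrim-suc 0 (removeAt m (column (suc m)))) (cong (1 ∷_) (removeAt-column m))

Down-column : ∀ h m → Down h (column (suc m)) ≡ h (column m)
Down-column h m = begin
  Down h col
    ≡⟨ Down-∑ col (suc m) h (isPartition-column (suc m)) (≤-reflexive (length-replicate (suc m))) ⟩
  ∑[ j < suc m ] term j
    ≡⟨ ∑-last m term ⟩
  ∑[ j < m ] term j + term m
    ≡⟨ cong₂ _+_ (∑-zero m (λ j j<m → cong (λ b → if b then h (removeAt j col) else 0) (upper j j<m)))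
                 bottom ⟩
  h (column m)
    ∎
  where
  open ≡-Reasoning
  col : List ℕ
  col = column (suc m)
  term : ℕ → ℕ
  term j = if removable (part col) j then h (removeAt j col) else 0
  upper : ∀ j → j < m → removable (part col) j ≡ false
  upper j j<m rewrite part-column {suc m} (s≤s j<m) | part-column {suc m} (m<n⇒m<1+n j<m) = refl
  bottom : term m ≡ h (column m)
  bottom rewrite part-beyond col (≤-reflexive (length-replicate (suc m))) | part-column {suc m} (n<1+n m) =
    cong h (removeAt-column m)

Down^-column : ∀ j m h → Down^ j h (column (j + m)) ≡ h (column m)
Down^-column zero    m h = refl
Down^-column (suc j) m h = trans (Down-column (Down^ j h) (j + m)) (Down^-column j m h)

-- Expansion in Stirling numbers

rowBasis : ℕ → ℕ → List ℕ → ℕ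
rowBasis n j = Down^ j (δ-oneRow (n ∸ j))

Down^-Up-δ-oneRow : ∀ n j L →
  Down^ (suc j) (Up (δ-oneRow (n ∸ j))) L ≡ (if j <ᵇ n then rowBasis n (suc j) L else 0)
Down^-Up-δ-oneRow n j L with j <ᵇ n in j<ᵇn
... | true  = Down-cong (Down^-cong j λ M p → trans (cong (λ m → Up (δ-oneRow m) M) n∸j≡1+n∸1+j)
                                                     (Up-δ-oneRow-suc (n ∸ suc j) M p)) L
  where
  n∸j≡1+n∸1+j : n ∸ j ≡ suc (n ∸ suc j)
  n∸j≡1+n∸1+j = +-∸-assoc 1 (<ᵇ⇒< j n (≡true⇒T j<ᵇn))
... | false = trans (Down-cong (Down^-cong j λ M p → trans (cong (λ m → Up (δ-oneRow m) M) n∸j≡0)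
                                                          (Up-δ-oneRow-zero M p)) L)
                    (Down^-zero (suc j) L)
  where
  n∸j≡0 : n ∸ j ≡ 0
  n∸j≡0 = m≤n⇒m∸n≡0 (≮⇒≥ λ j<n → subst T j<ᵇn (<⇒<ᵇ {j} {n} j<n))

Down-Up-rowBasis : ∀ n j L →
  Down (Up (rowBasis n j)) L ≡ j * rowBasis n j L + (if j <ᵇ n then rowBasis n (suc j) L else 0)
Down-Up-rowBasis n j L = begin
  Down (Up (rowBasis n j)) L
    ≡⟨ Down-Up-Down^ j (δ-oneRow (n ∸ j)) L ⟩
  Down^ (suc j) (Up (δ-oneRow (n ∸ j))) L + j * rowBasis n j L
    ≡⟨ +-comm _ (j * rowBasis n j L) ⟩
  j * rowBasis n j L + Down^ (suc j) (Up (δ-oneRow (n ∸ j))) L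
    ≡⟨ cong (j * rowBasis n j L +_) (Down^-Up-δ-oneRow n j L) ⟩
  j * rowBasis n j L + (if j <ᵇ n then rowBasis n (suc j) L else 0) ∎
  where open ≡-Reasoning

Down-Up-∑ : ∀ m (c : ℕ → ℕ) (h : ℕ → List ℕ → ℕ) L →
  Down (Up (λ M → ∑[ j < m ] (c j * h j M))) L ≡ ∑[ j < m ] (c j * Down (Up (h j)) L)
Down-Up-∑ m c h L =
  trans (Down-cong (λ M _ → sum-map-∑-* m c h (addCell M)) L) (sum-map-∑-* m c (Up ∘ h) (removeCell L))

∑-S-suc : ∀ K n (x : ℕ → ℕ) →
  ∑[ j < suc n ] (S K j * (j * x j + (if j <ᵇ n then x (suc j) else 0)))
    ≡ ∑[ j < suc n ] (S (suc K) j * x j)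
∑-S-suc K n x = begin
  ∑[ j < suc n ] (S K j * (j * x j + y j))
    ≡⟨ ∑-cong (suc n) (λ j _ → *-distribˡ-+ (S K j) (j * x j) (y j)) ⟩
  ∑[ j < suc n ] (S K j * (j * x j) + S K j * y j)
    ≡⟨ ∑-distrib-+ (suc n) (λ j → S K j * (j * x j)) (λ j → S K j * y j) ⟩
  ∑[ j < suc n ] (S K j * (j * x j)) + ∑[ j < suc n ] (S K j * y j)
    ≡⟨ cong₂ _+_ weighted shifted ⟩
  ∑[ j < n ] (suc j * S K (suc j) * x (suc j)) + ∑[ j < n ] (S K j * x (suc j))
    ≡⟨ ∑-distrib-+ n (λ j → suc j * S K (suc j) * x (suc j)) (λ j → S K j * x (suc j)) ⟨
  ∑[ j < n ] (suc j * S K (suc j) * x (suc j) + S K j * x (suc j))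
    ≡⟨ ∑-cong n (λ j _ → *-distribʳ-+ (x (suc j)) (suc j * S K (suc j)) (S K j)) ⟨
  ∑[ j < suc n ] (S (suc K) j * x j) ∎
  where
  open ≡-Reasoning
  y : ℕ → ℕ
  y j = if j <ᵇ n then x (suc j) else 0
  weighted : ∑[ j < suc n ] (S K j * (j * x j)) ≡ ∑[ j < n ] (suc j * S K (suc j) * x (suc j))
  weighted = cong₂ _+_ (*-zeroʳ (S K 0)) (∑-cong n λ j _ →
    trans (sym (*-assoc (S K (suc j)) (suc j) (x (suc j)))) (cong (_* x (suc j)) (*-comm (S K (suc j)) (suc j))))
  shifted : ∑[ j < suc n ] (S K j * y j) ≡ ∑[ j < n ] (S K j * x (suc j))
  shifted = begin
    ∑[ j < suc n ] (S K j * y j)           ≡⟨ ∑-last n (λ j → S K j * y j) ⟩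
    ∑[ j < n ] (S K j * y j) + S K n * y n ≡⟨ cong₂ _+_ (∑-cong n inside) last ⟩
    ∑[ j < n ] (S K j * x (suc j)) + 0     ≡⟨ +-identityʳ _ ⟩
    ∑[ j < n ] (S K j * x (suc j))         ∎
    where
    inside : ∀ j → j < n → S K j * y j ≡ S K j * x (suc j)
    inside j j<n = cong (λ b → S K j * (if b then x (suc j) else 0)) (T⇒≡true (<⇒<ᵇ j<n))
    n<ᵇn≡false : ∀ n → (n <ᵇ n) ≡ false
    n<ᵇn≡false zero    = refl
    n<ᵇn≡false (suc n) = n<ᵇn≡false n
    last : S K n * y n ≡ 0
    last = trans (cong (λ b → S K n * (if b then x (suc n) else 0)) (n<ᵇn≡false n)) (*-zeroʳ (S K n))

vacillating-oneRow-∑ : ∀ n K L →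
  vacillating L (row (suc n)) K ≡ ∑[ j < suc (suc n) ] (S K j * rowBasis (suc n) j L)
vacillating-oneRow-∑ n zero    L =
  sym (trans (cong₂ _+_ (*-identityˡ _) (∑-zero (suc n) (λ _ _ → refl))) (+-identityʳ _))
vacillating-oneRow-∑ n (suc K) L = begin
  Down (Up (λ M → vacillating M (row (suc n)) K)) L
    ≡⟨ Down-cong (λ M _ → Up-cong (λ M′ _ → vacillating-oneRow-∑ n K M′) M) L ⟩
  Down (Up (λ M → ∑[ j < suc (suc n) ] (S K j * rowBasis (suc n) j M))) L
    ≡⟨ Down-Up-∑ (suc (suc n)) (S K) (rowBasis (suc n)) L ⟩
  ∑[ j < suc (suc n) ] (S K j * Down (Up (rowBasis (suc n) j)) L)
    ≡⟨ ∑-cong (suc (suc n)) (λ j _ → cong (S K j *_) (Down-Up-rowBasis (suc n) j L)) ⟩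
  ∑[ j < suc (suc n) ] (S K j * (j * x j + (if j <ᵇ suc n then x (suc j) else 0)))
    ≡⟨ ∑-S-suc K (suc n) x ⟩
  ∑[ j < suc (suc n) ] (S (suc K) j * x j) ∎
  where
  open ≡-Reasoning
  x : ℕ → ℕ
  x j = rowBasis (suc n) j L

rowBasis-column : ∀ n j → j ≤ n → rowBasis n j (column n) ≡ δ-oneRow (n ∸ j) (column (n ∸ j))
rowBasis-column n j j≤n =
  subst (λ m → Down^ j (δ-oneRow (n ∸ j)) (column m) ≡ δ-oneRow (n ∸ j) (column (n ∸ j)))
        (m+[n∸m]≡n j≤n) (Down^-column j (n ∸ j) (δ-oneRow (n ∸ j)))

∑-rowBasis-column : ∀ n k →
  ∑[ j < suc (suc n) ] (S k j * rowBasis (suc n) j (column (suc n))) ≡ S k (suc n) + S k n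
∑-rowBasis-column n k = begin
  ∑[ j < suc (suc n) ] (S k j * rowBasis (suc n) j (column (suc n)))
    ≡⟨ ∑-cong (suc (suc n)) (λ j j≤n → cong (S k j *_) (rowBasis-column (suc n) j (≤-pred j≤n))) ⟩
  ∑[ j < suc (suc n) ] term j
    ≡⟨ trans (∑-last (suc n) term) (cong (_+ term (suc n)) (∑-last n term)) ⟩
  ∑[ j < n ] term j + term n + term (suc n)
    ≡⟨ cong₂ _+_ (cong₂ _+_ (∑-zero n below) middle) top ⟩
  S k n + S k (suc n)
    ≡⟨ +-comm (S k n) (S k (suc n)) ⟩
  S k (suc n) + S k n ∎
  where
  open ≡-Reasoning
  term : ℕ → ℕ
  term j = S k j * δ-oneRow (suc n ∸ j) (column (suc n ∸ j))
  below : ∀ j → j < n → term j ≡ 0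
  below j j<n = trans (cong (λ m → S k j * δ-oneRow m (column m)) (+-∸-assoc 2 j<n)) (*-zeroʳ (S k j))
  middle : term n ≡ S k n
  middle = trans (cong (λ m → S k n * δ-oneRow m (column m)) (m+n∸n≡m 1 n)) (*-identityʳ (S k n))
  top : term (suc n) ≡ S k (suc n)
  top = trans (cong (λ m → S k (suc n) * δ-oneRow m (column m)) (n∸n≡0 n)) (*-identityʳ (S k (suc n)))

mainTheorem2 : (n k : ℕ) → 1 ≤ n → 1 ≤ k →
    S k n + S k (n ∸ 1) ≡ vacillating (column n) (row n) k
mainTheorem2 zero    k () _
mainTheorem2 (suc n) k _  _ = sym (begin
  vacillating (column (suc n)) (row (suc n)) k
    ≡⟨ vacillating-oneRow-∑ n k (column (suc n)) ⟩
  ∑[ j < suc (suc n) ] (S k j * rowBasis (suc n) j (column (suc n)))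
    ≡⟨ ∑-rowBasis-column n k ⟩
  S k (suc n) + S k n ∎)
  where open ≡-Reasoning
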